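{- Let $r\geq 1$ and let $m_{1},\ldots,m_{r}\geq 2$ be integers. Define power series in $\mathbb{Z}[[q]]$ by $H_{\emptyset}=\frac{q}{1-q}$ and, recursively for $k=1,\ldots,r$, \[ H_{(m_{1},\ldots,m_{k})}=U_{m_{k}}\!\left(\frac{1}{1-q}H_{(m_{1},\ldots,m_{k-1})}\right). \] Then every coefficient of $H_{(m_{1},\ldots,m_{r})}$ is divisible by $\prod_{t=1}^{r}\mathcal{M}(m_{t},t)$.
   Context: $U_{m}:\mathbb{Z}[[q]]\to\mathbb{Z}[[q]]$ is the linear operator $U_{m}\big(\sum_{n\geq 0}a(n)q^{n}\big)=\sum_{n\geq 0}a(mn)q^{n}$. For positive integers $m$ and $t$, $\mathcal{M}(m,t):=\frac{m}{\gcd\big(m,\operatorname{lcm}(1,\ldots,t)\big)}$. -}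

module Defs where

open import Data.Nat using (ℕ; zero; suc; _*_; _/_; _≤_; _<_)
open import Data.Nat.GCD using (gcd)
open import Data.Nat.LCM using (lcm)
open import Data.Integer using (ℤ; +_)
import Data.Integer as ℤ
open import Data.Fin using (Fin; toℕ; fromℕ<; inject₁)
import Data.Nat.Properties

-- A formal power series in ℤ[[q]], represented by its coefficient sequence.
Series : Set
Series = ℕ → ℤ

U : ℕ → Series → Series
U m f n = f (m * n)

-- Multiplication by 1/(1-q) = Σ qⁱ : coefficient n is Σ_{i=0}^{n} f(i).
partialSums : Series → Series
partialSums f zero    = f zero
partialSums f (suc n) = partialSums f n ℤ.+ f (suc n)

mulGeom : Series → Series
mulGeom = partialSums

Hempty : Series
Hempty zero    = + 0
Hempty (suc n) = + 1

lcmUpTo : ℕ → ℕ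
lcmUpTo zero    = 1
lcmUpTo (suc t) = lcm (lcmUpTo t) (suc t)

-- 𝓜(m,t) = m / gcd(m, lcm(1,…,t)); the division is exact.
-- gcd(m, lcmUpTo t) ≠ 0 since lcmUpTo t ≥ 1, so the zero branch is unreachable.
𝓜 : ℕ → ℕ → ℕ
𝓜 m t with gcd m (lcmUpTo t)
... | zero    = 0
... | suc g   = m / suc g

H : ∀ {r} → (Fin r → ℕ) → (k : ℕ) → k ≤ r → Series
H ms zero    _   = Hempty
H ms (suc k) k<r = U (ms (fromℕ< k<r)) (mulGeom (H ms k (lower k<r)))
  where
  lower : ∀ {a b} → suc a ≤ b → a ≤ b
  lower = Data.Nat.Properties.<⇒≤

prodM : ∀ {r} → (Fin r → ℕ) → ℕ
prodM {zero}  ms = 1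
prodM {suc r} ms = prodM {r} (λ i → ms (inject₁ i)) * 𝓜 (ms (fromℕ< (Data.Nat.Properties.n<1+n r))) (suc r)

module Submission where

-- Let Gₖ = H_{(m₁,…,mₖ)}/(1−q). By induction on k, n ↦ Gₖ(n) is a polynomial of degree
-- at most k+1 vanishing at 0 whose values are divisible by ∏_{t≤k} 𝓜(mₜ,t). Such a
-- polynomial g of degree at most t has the Newton expansion g(N) = Σ_{j≤t} C(N,j)·Δʲg(0),
-- where every Δʲg(0) inherits the divisibility of g and the j = 0 term vanishes. For
-- 1 ≤ j ≤ t the coefficient C(mn,j) is divisible by 𝓜(m,t): m divides j·C(mn,j) =
-- mn·C(mn−1,j−1), j divides L = lcm(1,…,t), and m/gcd(m,L) is coprime to L/gcd(m,L).
-- So U_m, which maps g to n ↦ g(mn), multiplies the divisor by 𝓜(m,t) without raising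
-- the degree, and 1/(1−q) raises the degree by one.

open import Data.Nat.Base using (ℕ; zero; suc; _≤_; _<_; z≤n; s≤s)
open import Function.Base using (_∘_)
open import Relation.Binary.PropositionalEquality
  using (_≡_; _≢_; refl; sym; trans; cong; cong₂; subst; subst₂; module ≡-Reasoning)
open import Defs

module Binomial where
  open import Data.Nat.Base using (_+_; _*_; _/_; NonZero)
  open import Data.Nat.Properties
    using (+-identityʳ; *-identityʳ; *-zeroʳ; m*n≡0⇒m≡0∨n≡0; m≤n⇒m<n∨m≡n)
  open import Data.Nat.Divisibility
    using (_∣_; _∣0; ∣-trans; ∣n⇒∣m*n; ∣m⇒∣m*n; *-monoˡ-∣; *-cancelʳ-∣)
  open import Data.Nat.GCD using (gcd; gcd[m,n]∣m; gcd[m,n]∣n; gcd[m,n]≡0⇒n≡0)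
  open import Data.Nat.LCM using (m∣lcm[m,n]; n∣lcm[m,n]; gcd*lcm)
  open import Data.Nat.Coprimality using (coprime-/gcd; coprime-divisor)
  open import Data.Nat.DivMod using (/-congʳ; m/n*n≡m)
  open import Data.Nat.Combinatorics using (_C_; nCk+nC[k+1]≡[n+1]C[k+1]; nC1≡n)
  open import Data.Nat.Tactic.RingSolver using (solve-∀)
  open import Data.Sum.Base using (inj₁; inj₂)
  open import Data.Empty using (⊥-elim)

  [k+1]*[n+1]C[k+1]≡[n+1]*nCk : ∀ n k → suc k * (suc n C suc k) ≡ suc n * (n C k)
  [k+1]*[n+1]C[k+1]≡[n+1]*nCk zero    zero    = refl
  [k+1]*[n+1]C[k+1]≡[n+1]*nCk zero    (suc k) = *-zeroʳ (suc (suc k))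
  [k+1]*[n+1]C[k+1]≡[n+1]*nCk (suc n) zero    =
    trans (+-identityʳ _) (trans (nC1≡n (suc (suc n))) (sym (*-identityʳ (suc (suc n)))))
  [k+1]*[n+1]C[k+1]≡[n+1]*nCk (suc n) (suc k) = begin
    suc (suc k) * (suc (suc n) C suc (suc k))
      ≡⟨ cong (suc (suc k) *_) (sym (nCk+nC[k+1]≡[n+1]C[k+1] (suc n) (suc k))) ⟩
    suc (suc k) * (a + b)
      ≡⟨ expand (suc k) a b ⟩
    (suc k * a + a) + suc (suc k) * b
      ≡⟨ cong₂ (λ x y → (x + a) + y) ([k+1]*[n+1]C[k+1]≡[n+1]*nCk n k)
                                     ([k+1]*[n+1]C[k+1]≡[n+1]*nCk n (suc k)) ⟩
    (suc n * (n C k) + a) + suc n * (n C suc k)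
      ≡⟨ cong (λ x → (suc n * (n C k) + x) + suc n * (n C suc k)) (sym (nCk+nC[k+1]≡[n+1]C[k+1] n k)) ⟩
    (suc n * (n C k) + (n C k + n C suc k)) + suc n * (n C suc k)
      ≡⟨ collect (suc n) (n C k) (n C suc k) ⟩
    suc (suc n) * (n C k + n C suc k)
      ≡⟨ cong (suc (suc n) *_) (nCk+nC[k+1]≡[n+1]C[k+1] n k) ⟩
    suc (suc n) * (suc n C suc k) ∎
    where
    open ≡-Reasoning
    a = suc n C suc k
    b = suc n C suc (suc k)
    expand : ∀ k a b → (1 + k) * (a + b) ≡ (k * a + a) + (1 + k) * b
    expand = solve-∀
    collect : ∀ n x y → (n * x + (x + y)) + n * y ≡ (1 + n) * (x + y)
    collect = solve-∀

  m∣n⇒m∣[k+1]*nC[k+1] : ∀ {m N} k → m ∣ N → m ∣ suc k * (N C suc k)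
  m∣n⇒m∣[k+1]*nC[k+1] {m} {zero}  k _   = ∣n⇒∣m*n (suc k) (m ∣0)
  m∣n⇒m∣[k+1]*nC[k+1] {m} {suc N} k m∣N =
    subst (m ∣_) (sym ([k+1]*[n+1]C[k+1]≡[n+1]*nCk N k)) (∣m⇒∣m*n (N C k) m∣N)

  m∣n*o⇒m/gcd[m,n]∣o : ∀ {m n o} .{{_ : NonZero (gcd m n)}} → m ∣ n * o → m / gcd m n ∣ o
  m∣n*o⇒m/gcd[m,n]∣o {m} {n} {o} m∣n*o =
    coprime-divisor (coprime-/gcd m n) (*-cancelʳ-∣ g (subst₂ _∣_ m≡ n*o≡ m∣n*o))
    where
    g = gcd m n
    m≡ : m ≡ m / g * g
    m≡ = sym (m/n*n≡m (gcd[m,n]∣m m n))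
    n*o≡ : n * o ≡ n / g * o * g
    n*o≡ = begin
      n * o         ≡⟨ cong (_* o) (sym (m/n*n≡m (gcd[m,n]∣n m n))) ⟩
      n / g * g * o ≡⟨ swap (n / g) g o ⟩
      n / g * o * g ∎
      where
      open ≡-Reasoning
      swap : ∀ x y z → x * y * z ≡ x * z * y
      swap = solve-∀

  lcmUpTo≢0 : ∀ t → lcmUpTo t ≢ 0
  lcmUpTo≢0 zero ()
  lcmUpTo≢0 (suc t) L≡0 with m*n≡0⇒m≡0∨n≡0 (lcmUpTo t) {suc t} L*t≡0
    where
    L*t≡0 : lcmUpTo t * suc t ≡ 0
    L*t≡0 = trans (sym (gcd*lcm (lcmUpTo t) (suc t)))
                  (trans (cong (gcd (lcmUpTo t) (suc t) *_) L≡0) (*-zeroʳ (gcd (lcmUpTo t) (suc t))))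
  ... | inj₁ L≡0′ = lcmUpTo≢0 t L≡0′
  ... | inj₂ ()

  ≤⇒∣lcmUpTo : ∀ {j t} → suc j ≤ t → suc j ∣ lcmUpTo t
  ≤⇒∣lcmUpTo {j} {suc t} (s≤s j≤t) with m≤n⇒m<n∨m≡n j≤t
  ... | inj₁ j<t  = ∣-trans (≤⇒∣lcmUpTo j<t) (m∣lcm[m,n] (lcmUpTo t) (suc t))
  ... | inj₂ refl = n∣lcm[m,n] (lcmUpTo j) (suc j)

  m∣lcmUpTo*o⇒𝓜∣o : ∀ m t {o} → m ∣ lcmUpTo t * o → 𝓜 m t ∣ o
  m∣lcmUpTo*o⇒𝓜∣o m t {o} m∣Lo with gcd m (lcmUpTo t) in eq
  ... | zero  = ⊥-elim (lcmUpTo≢0 t (gcd[m,n]≡0⇒n≡0 m eq))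
  ... | suc g = subst (_∣ o) (/-congʳ eq) (m∣n*o⇒m/gcd[m,n]∣o m∣Lo)
    where instance _ = subst NonZero (sym eq) _

  m∣n⇒𝓜∣nC[k+1] : ∀ {m t N k} → suc k ≤ t → m ∣ N → 𝓜 m t ∣ N C suc k
  m∣n⇒𝓜∣nC[k+1] {m} {t} {N} {k} k<t m∣N =
    m∣lcmUpTo*o⇒𝓜∣o m t
      (∣-trans (m∣n⇒m∣[k+1]*nC[k+1] k m∣N) (*-monoˡ-∣ (N C suc k) (≤⇒∣lcmUpTo k<t)))

module FiniteDifferences where
  open import Data.Nat.Base as ℕ using ()
  open import Data.Nat.Properties using (+-suc; *-suc)
  open import Data.Nat.Combinatorics using (_C_; nCk+nC[k+1]≡[n+1]C[k+1])
  open import Data.Integer.Base using (ℤ; +_; 0ℤ; _+_; _-_; _*_)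
  open import Data.Integer.Properties
    using (+-identityʳ; +-inverseʳ; *-identityˡ; *-zeroʳ; *-distribˡ-+; *-distribʳ-+; pos-+)
  open import Data.Integer.Divisibility.Signed using (_∣_; divides; ∣m∣n⇒∣m+n; ∣m∣n⇒∣m-n)
  open import Data.Integer.Tactic.RingSolver using (solve-∀)

  Δ : Series → Series
  Δ f n = f (suc n) - f n

  Δ^ : ℕ → Series → Series
  Δ^ zero    f = f
  Δ^ (suc k) f = Δ^ k (Δ f)

  DegreeBelow : ℕ → Series → Set
  DegreeBelow d f = ∀ n → Δ^ d f n ≡ 0ℤ

  -- ∑< m F = F 0 + … + F (m − 1), peeling off the first term so that reindexing by suc is
  -- definitional.
  ∑< : ℕ → (ℕ → ℤ) → ℤ
  ∑< zero    F = 0ℤ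
  ∑< (suc m) F = F 0 + ∑< m (F ∘ suc)

  ∑<-cong : ∀ m {F G} → (∀ i → F i ≡ G i) → ∑< m F ≡ ∑< m G
  ∑<-cong zero    F≗G = refl
  ∑<-cong (suc m) F≗G = cong₂ _+_ (F≗G 0) (∑<-cong m (F≗G ∘ suc))

  ∑<-0 : ∀ m → ∑< m (λ _ → 0ℤ) ≡ 0ℤ
  ∑<-0 zero    = refl
  ∑<-0 (suc m) = cong (_+_ 0ℤ) (∑<-0 m)

  ∑<-+ : ∀ m F G → ∑< m (λ i → F i + G i) ≡ ∑< m F + ∑< m G
  ∑<-+ zero    F G = refl
  ∑<-+ (suc m) F G =
    trans (cong (_+_ (F 0 + G 0)) (∑<-+ m (F ∘ suc) (G ∘ suc))) (interchange (F 0) (G 0) _ _)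
    where
    interchange : ∀ a b c d → (a + b) + (c + d) ≡ (a + c) + (b + d)
    interchange = solve-∀

  ∑<-suc≡∑< : ∀ m F → F m ≡ 0ℤ → ∑< (suc m) F ≡ ∑< m F
  ∑<-suc≡∑< zero    F F0≡0 = trans (+-identityʳ (F 0)) F0≡0
  ∑<-suc≡∑< (suc m) F Fm≡0 = cong (_+_ (F 0)) (∑<-suc≡∑< m (F ∘ suc) Fm≡0)

  ∣-∑< : ∀ {d} m {F} → (∀ i → i < m → d ∣ F i) → d ∣ ∑< m F
  ∣-∑< zero    d∣F = divides 0ℤ refl
  ∣-∑< (suc m) d∣F =
    ∣m∣n⇒∣m+n (d∣F 0 (s≤s z≤n)) (∣-∑< m (λ i i<m → d∣F (suc i) (s≤s i<m)))

  Δ^-cong : ∀ k {f g : Series} → (∀ n → f n ≡ g n) → ∀ n → Δ^ k f n ≡ Δ^ k g n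
  Δ^-cong zero    f≗g = f≗g
  Δ^-cong (suc k) f≗g = Δ^-cong k (λ n → cong₂ _-_ (f≗g (suc n)) (f≗g n))

  Δ^-Δ : ∀ k f n → Δ^ k (Δ f) n ≡ Δ (Δ^ k f) n
  Δ^-Δ zero    f n = refl
  Δ^-Δ (suc k) f n = Δ^-Δ k (Δ f) n

  Δ^-+ : ∀ k f g n → Δ^ k (λ x → f x + g x) n ≡ Δ^ k f n + Δ^ k g n
  Δ^-+ zero    f g n = refl
  Δ^-+ (suc k) f g n =
    trans (Δ^-cong k (λ x → sub-+ (f (suc x)) (g (suc x)) (f x) (g x)) n) (Δ^-+ k (Δ f) (Δ g) n)
    where
    sub-+ : ∀ a b c d → (a + b) - (c + d) ≡ (a - c) + (b - d)
    sub-+ = solve-∀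

  Δ^-∘ : ∀ {σ : ℕ → ℕ} → (∀ x → σ (suc x) ≡ suc (σ x)) →
         ∀ k f n → Δ^ k (f ∘ σ) n ≡ Δ^ k f (σ n)
  Δ^-∘ σ-suc zero    f n = refl
  Δ^-∘ {σ} σ-suc (suc k) f n =
    trans (Δ^-cong k (λ x → cong (λ y → f y - f (σ x)) (σ-suc x)) n) (Δ^-∘ σ-suc k (Δ f) n)

  telescope : ∀ m f x → f (m ℕ.+ x) - f x ≡ ∑< m (λ i → Δ f (i ℕ.+ x))
  telescope zero    f x = +-inverseʳ (f x)
  telescope (suc m) f x =
    trans (split (f x) (f (suc x)) (f (suc (m ℕ.+ x)))) (cong (_+_ (Δ f x)) (telescope m (f ∘ suc) x))
    where
    split : ∀ a b c → c - a ≡ (b - a) + (c - b)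
    split = solve-∀

  DegreeBelow-cong : ∀ {d f g} → (∀ n → f n ≡ g n) → DegreeBelow d f → DegreeBelow d g
  DegreeBelow-cong {d} f≗g deg n = trans (sym (Δ^-cong d f≗g n)) (deg n)

  DegreeBelow-0 : ∀ d → DegreeBelow d (λ _ → 0ℤ)
  DegreeBelow-0 zero    n = refl
  DegreeBelow-0 (suc d) n = DegreeBelow-0 d n

  DegreeBelow-+ : ∀ {d f g} → DegreeBelow d f → DegreeBelow d g → DegreeBelow d (λ x → f x + g x)
  DegreeBelow-+ {d} {f} {g} deg-f deg-g n = trans (Δ^-+ d f g n) (cong₂ _+_ (deg-f n) (deg-g n))

  DegreeBelow-∑< : ∀ {d} m {F : ℕ → Series} → (∀ i → DegreeBelow d (F i)) →
                   DegreeBelow d (λ x → ∑< m (λ i → F i x))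
  DegreeBelow-∑< {d} zero    deg = DegreeBelow-0 d
  DegreeBelow-∑< {d} (suc m) deg = DegreeBelow-+ {d} (deg 0) (DegreeBelow-∑< {d} m (deg ∘ suc))

  DegreeBelow-translate : ∀ {d f} i → DegreeBelow d f → DegreeBelow d (λ x → f (i ℕ.+ x))
  DegreeBelow-translate {d} {f} i deg n = trans (Δ^-∘ (+-suc i) d f n) (deg (i ℕ.+ n))

  DegreeBelow-U : ∀ {d f} m → DegreeBelow d f → DegreeBelow d (U m f)
  DegreeBelow-U {zero}      m deg n = deg (m ℕ.* n)
  DegreeBelow-U {suc d} {f} m deg =
    DegreeBelow-cong {d} (λ n → sym (Δ-U n))
      (DegreeBelow-U {d} m (DegreeBelow-∑< {d} m (λ i → DegreeBelow-translate {d} {Δ f} i deg)))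
    where
    Δ-U : ∀ n → Δ (U m f) n ≡ ∑< m (λ i → Δ f (i ℕ.+ m ℕ.* n))
    Δ-U n = trans (cong (λ x → f x - f (m ℕ.* n)) (*-suc m n)) (telescope m f (m ℕ.* n))

  DegreeBelow-partialSums : ∀ {d h} → DegreeBelow d (h ∘ suc) → DegreeBelow (suc d) (partialSums h)
  DegreeBelow-partialSums {d} {h} = DegreeBelow-cong {d} (λ n → sym (Δ-partialSums n))
    where
    cancel : ∀ a b → (a + b) - a ≡ b
    cancel = solve-∀
    Δ-partialSums : ∀ n → Δ (partialSums h) n ≡ h (suc n)
    Δ-partialSums n = cancel (partialSums h n) (h (suc n))

  ∣-Δ^ : ∀ {d f} → (∀ n → d ∣ f n) → ∀ k n → d ∣ Δ^ k f n
  ∣-Δ^ d∣f zero    = d∣f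
  ∣-Δ^ d∣f (suc k) = ∣-Δ^ (λ n → ∣m∣n⇒∣m-n (d∣f (suc n)) (d∣f n)) k

  ∣-partialSums : ∀ {d h} → (∀ n → d ∣ h n) → ∀ n → d ∣ partialSums h n
  ∣-partialSums d∣h zero    = d∣h zero
  ∣-partialSums d∣h (suc n) = ∣m∣n⇒∣m+n (∣-partialSums d∣h n) (d∣h (suc n))

  ∑<-pascal : ∀ d N (a : ℕ → ℤ) → a d ≡ 0ℤ →
              ∑< d (λ j → + (N C j) * (a j + a (suc j))) ≡ ∑< d (λ j → + (suc N C j) * a j)
  ∑<-pascal zero    N a _      = refl
  ∑<-pascal (suc d) N a ad≡0 = begin
    ∑< (suc d) (λ j → c N j * (a j + a (suc j)))
      ≡⟨ ∑<-cong (suc d) (λ j → *-distribˡ-+ (c N j) (a j) (a (suc j))) ⟩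
    ∑< (suc d) (λ j → c N j * a j + c N j * a (suc j))
      ≡⟨ ∑<-+ (suc d) (λ j → c N j * a j) (λ j → c N j * a (suc j)) ⟩
    ∑< (suc d) (λ j → c N j * a j) + ∑< (suc d) (λ j → c N j * a (suc j))
      ≡⟨ cong (_+_ (∑< (suc d) (λ j → c N j * a j)))
              (∑<-suc≡∑< d (λ j → c N j * a (suc j)) last≡0) ⟩
    (c N 0 * a 0 + Y) + X
      ≡⟨ rearrange (c N 0 * a 0) Y X ⟩
    c N 0 * a 0 + (X + Y)
      ≡⟨ cong (_+_ (c N 0 * a 0))
              (sym (∑<-+ d (λ j → c N j * a (suc j)) (λ j → c N (suc j) * a (suc j)))) ⟩
    c N 0 * a 0 + ∑< d (λ j → c N j * a (suc j) + c N (suc j) * a (suc j))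
      ≡⟨ cong (_+_ (c N 0 * a 0)) (∑<-cong d pascal) ⟩
    c (suc N) 0 * a 0 + ∑< d (λ j → c (suc N) (suc j) * a (suc j))
      ∎
    where
    open ≡-Reasoning
    c : ℕ → ℕ → ℤ
    c n j = + (n C j)
    X = ∑< d (λ j → c N j * a (suc j))
    Y = ∑< d (λ j → c N (suc j) * a (suc j))
    last≡0 : c N d * a (suc d) ≡ 0ℤ
    last≡0 = trans (cong (c N d *_) ad≡0) (*-zeroʳ (c N d))
    rearrange : ∀ p y x → (p + y) + x ≡ p + (x + y)
    rearrange = solve-∀
    pascal : ∀ j → c N j * a (suc j) + c N (suc j) * a (suc j) ≡ c (suc N) (suc j) * a (suc j)
    pascal j = begin
      c N j * a (suc j) + c N (suc j) * a (suc j)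
        ≡⟨ *-distribʳ-+ (a (suc j)) (c N j) (c N (suc j)) ⟨
      (c N j + c N (suc j)) * a (suc j)
        ≡⟨ cong (_* a (suc j)) (pos-+ (N C j) (N C suc j)) ⟨
      + (N C j ℕ.+ N C suc j) * a (suc j)
        ≡⟨ cong (λ x → + x * a (suc j)) (nCk+nC[k+1]≡[n+1]C[k+1] N j) ⟩
      c (suc N) (suc j) * a (suc j)
        ∎

  newton-expansion : ∀ {d f} → DegreeBelow d f → ∀ N → f N ≡ ∑< d (λ j → + (N C j) * Δ^ j f 0)
  newton-expansion {zero}          deg zero = deg 0
  newton-expansion {suc d} {f}     deg zero = sym (begin
    + 1 * f 0 + ∑< d (λ _ → 0ℤ) ≡⟨ cong₂ _+_ (*-identityˡ (f 0)) (∑<-0 d) ⟩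
    f 0 + 0ℤ                    ≡⟨ +-identityʳ (f 0) ⟩
    f 0                         ∎)
    where open ≡-Reasoning
  newton-expansion {d}     {f}     deg (suc N) = begin
    f (suc N)
      ≡⟨ newton-expansion {d} {f ∘ suc} (DegreeBelow-translate {d} {f} 1 deg) N ⟩
    ∑< d (λ j → + (N C j) * Δ^ j (f ∘ suc) 0)
      ≡⟨ ∑<-cong d (λ j → cong (+ (N C j) *_) (Δ^-suc j)) ⟩
    ∑< d (λ j → + (N C j) * (a j + a (suc j)))
      ≡⟨ ∑<-pascal d N a (deg 0) ⟩
    ∑< d (λ j → + (suc N C j) * a j)
      ∎
    where
    open ≡-Reasoning
    a : ℕ → ℤ
    a j = Δ^ j f 0
    add-sub : ∀ x y → x ≡ y + (x - y)
    add-sub = solve-∀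
    Δ^-suc : ∀ j → Δ^ j (f ∘ suc) 0 ≡ a j + a (suc j)
    Δ^-suc j = begin
      Δ^ j (f ∘ suc) 0          ≡⟨ Δ^-∘ (λ _ → refl) j f 0 ⟩
      Δ^ j f 1                  ≡⟨ add-sub (Δ^ j f 1) (a j) ⟩
      a j + Δ (Δ^ j f) 0        ≡⟨ cong (_+_ (a j)) (sym (Δ^-Δ j f 0)) ⟩
      a j + a (suc j)           ∎

module Recurrence where
  open import Data.Nat.Base using (_*_)
  open import Data.Nat.Properties using (<⇒≤; *-zeroʳ; m<n⇒m<1+n; m≤n⇒m≤1+n; ≤-refl)
  open import Data.Nat.Divisibility using (m∣m*n)
  open import Data.Nat.Combinatorics using (_C_)
  open import Data.Fin.Base using (Fin; fromℕ<; inject₁)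
  open import Data.Fin.Properties using (toℕ-injective; toℕ-inject₁; toℕ-fromℕ<)
  open import Data.Integer.Base as ℤ using (+_; 0ℤ)
  open import Data.Integer.Properties using (pos-*; *-comm; *-identityʳ)
  open import Data.Integer.Divisibility.Signed
    using (_∣_; divides; ∣-trans; ∣ᵤ⇒∣; ∣n⇒∣m*n; *-monoˡ-∣; *-monoʳ-∣)
  open Binomial
  open FiniteDifferences

  record DivisiblePolynomial (d D : ℕ) (g : Series) : Set where
    field
      degree      : DegreeBelow d g
      vanishesAt0 : g 0 ≡ 0ℤ
      divisible   : ∀ n → + D ∣ g n

  *-pres-∣ : ∀ {a b c d} → a ∣ b → c ∣ d → a ℤ.* c ∣ b ℤ.* d
  *-pres-∣ {b = b} {c} a∣b c∣d = ∣-trans (*-monoˡ-∣ c a∣b) (*-monoʳ-∣ b c∣d)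

  U-preserves : ∀ {t D g} m → DivisiblePolynomial (suc t) D g →
                DivisiblePolynomial (suc t) (D * 𝓜 m t) (U m g)
  U-preserves {t} {D} {g} m P = record
    { degree      = DegreeBelow-U {suc t} {g} m degree
    ; vanishesAt0 = trans (cong g (*-zeroʳ m)) vanishesAt0
    ; divisible   = λ n → subst (+ (D * 𝓜 m t) ∣_) (sym (newton-expansion {suc t} {g} degree (m * n)))
                                (∣-∑< (suc t) (newton-term n))
    }
    where
    open DivisiblePolynomial P
    newton-term : ∀ n j → j < suc t → + (D * 𝓜 m t) ∣ + ((m * n) C j) ℤ.* Δ^ j g 0
    newton-term n zero    _         = ∣n⇒∣m*n (+ 1) (subst (_ ∣_) (sym vanishesAt0) (divides 0ℤ refl))
    newton-term n (suc j) (s≤s j<t) =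
      subst₂ _∣_ (sym (pos-* D (𝓜 m t))) (*-comm (Δ^ (suc j) g 0) (+ ((m * n) C suc j)))
        (*-pres-∣ (∣-Δ^ divisible (suc j) 0) (∣ᵤ⇒∣ (m∣n⇒𝓜∣nC[k+1] {m} {t} j<t (m∣m*n n))))

  partialSums-preserves : ∀ {d D h} → DivisiblePolynomial d D h →
                          DivisiblePolynomial (suc d) D (partialSums h)
  partialSums-preserves {d} P = record
    { degree      = DegreeBelow-partialSums {d} (DegreeBelow-translate {d} 1 degree)
    ; vanishesAt0 = vanishesAt0
    ; divisible   = ∣-partialSums divisible
    }
    where open DivisiblePolynomial P

  prodMUpTo : ∀ {r} → (Fin r → ℕ) → (k : ℕ) → .(k ≤ r) → ℕ
  prodMUpTo ms zero    _   = 1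
  prodMUpTo ms (suc k) k<r = prodMUpTo ms k (<⇒≤ k<r) * 𝓜 (ms (fromℕ< k<r)) (suc k)

  partialSums-H : ∀ {r} (ms : Fin r → ℕ) k (k≤r : k ≤ r) →
                  DivisiblePolynomial (suc (suc k)) (prodMUpTo ms k k≤r) (partialSums (H ms k k≤r))
  partialSums-H ms zero    _   = record
    { degree      = DegreeBelow-partialSums {1} {Hempty} (λ _ → refl)
    ; vanishesAt0 = refl
    ; divisible   = λ n → divides (partialSums Hempty n) (sym (*-identityʳ (partialSums Hempty n)))
    }
  partialSums-H ms (suc k) k<r =
    partialSums-preserves (U-preserves (ms (fromℕ< k<r)) (partialSums-H ms k (<⇒≤ k<r)))

  inject₁-fromℕ< : ∀ {k r} .(k<r : k < r) → inject₁ (fromℕ< k<r) ≡ fromℕ< (m<n⇒m<1+n k<r)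
  inject₁-fromℕ< k<r = toℕ-injective
    (trans (toℕ-inject₁ (fromℕ< k<r)) (trans (toℕ-fromℕ< k<r) (sym (toℕ-fromℕ< (m<n⇒m<1+n k<r)))))

  prodMUpTo-inject₁ : ∀ {r} (ms : Fin (suc r) → ℕ) k .(k≤r : k ≤ r) →
                      prodMUpTo (ms ∘ inject₁) k k≤r ≡ prodMUpTo ms k (m≤n⇒m≤1+n k≤r)
  prodMUpTo-inject₁ ms zero    _   = refl
  prodMUpTo-inject₁ ms (suc k) k<r =
    cong₂ _*_ (prodMUpTo-inject₁ ms k (<⇒≤ k<r))
              (cong (λ i → 𝓜 (ms i) (suc k)) (inject₁-fromℕ< k<r))

  prodM≡prodMUpTo : ∀ {r} (ms : Fin r → ℕ) → prodM ms ≡ prodMUpTo ms r ≤-refl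
  prodM≡prodMUpTo {zero}  ms = refl
  prodM≡prodMUpTo {suc r} ms = cong (_* 𝓜 (ms (fromℕ< ≤-refl)) (suc r))
    (trans (prodM≡prodMUpTo (ms ∘ inject₁)) (prodMUpTo-inject₁ ms r ≤-refl))

  prodM∣H : ∀ {r} (ms : Fin (suc r) → ℕ) n → + prodM ms ∣ H ms (suc r) ≤-refl n
  prodM∣H {r} ms n = subst (λ D → + D ∣ H ms (suc r) ≤-refl n) (sym (prodM≡prodMUpTo ms))
    (divisible (U-preserves (ms (fromℕ< ≤-refl)) (partialSums-H ms r (<⇒≤ ≤-refl))) n)
    where open DivisiblePolynomial

open Recurrence using (prodM∣H)
open import Data.Fin.Base using (Fin)
open import Data.Integer.Base using (+_)
open import Data.Integer.Divisibility using (_∣_)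
open import Data.Integer.Divisibility.Signed using (∣⇒∣ᵤ)
open import Data.Nat.Properties using (≤-refl)

-- The argument works for every mᵢ.
lemma2p7 : (r : ℕ) → 1 ≤ r → (ms : Fin r → ℕ) → (∀ i → 2 ≤ ms i) →
    (n : ℕ) → + (prodM ms) ∣ H ms r ≤-refl n
lemma2p7 (suc r) _ ms _ n = ∣⇒∣ᵤ (prodM∣H ms n)
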